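{- Let $r\in\mathbb{N}_0$, let $a_1,\dots,a_r\in\mathbb{N}_0$ and $a_{r+1}\in\mathbb{N}$, and put $\mathbf{s}=(\{2\}^{a_1},1,\dots,\{2\}^{a_r},1,\{2\}^{a_{r+1}})$. Then for every $n\in\mathbb{N}$, \[ H^\star_n(\mathbf{s})=-\sum_{\mathbf{p}\in\Pi(2a_1+1,\,\dots,\,2a_r+1,\,\overline{2a_{r+1}})}2^{\ell(\mathbf{p})}\,\mathcal{H}_n(\mathbf{p}). \]
   Context: $\mathbb{N}=\{1,2,\dots\}$, $\mathbb{N}_0=\mathbb{N}\cup\{0\}$; for a positive integer $m$, $\overline{m}$ denotes $-m$. For $\mathbf{s}=(s_1,\dots,s_\ell)$ with nonzero integer entries, $H_n(\mathbf{s})=\sum_{n\ge k_1>\cdots>k_\ell\ge1}\prod_{i=1}^\ell \frac{\operatorname{sgn}(s_i)^{k_i}}{k_i^{|s_i|}}$ and $H^\star_n(\mathbf{s})=\sum_{n\ge k_1\ge\cdots\ge k_\ell\ge1}\prod_{i=1}^\ell \frac{\operatorname{sgn}(s_i)^{k_i}}{k_i^{|s_i|}}$, with $H_n(\mathbf{s})=0$ if $n<\ell$ and $H_n(\emptyset)=H^\star_n(\emptyset)=1$. $\{2\}^a$ denotes $a$ copies of $2$. For nonzero integers $a,b$, $a\oplus b=\operatorname{sgn}(a)b+\operatorname{sgn}(b)a$. For a sequence $(s_1,\dots,s_m)$ of nonzero integers, $\Pi(s_1,\dots,s_m)$ is the set of the $2^{m-1}$ indices $s_1\circ\cdots\circ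 s_m$ where each $\circ$ is independently either "," or $\oplus$ (entries joined by $\oplus$ merge into one component); $\ell(\mathbf{p})$ is the number of components. For $\mathbf{p}=(p_1,\dots,p_m)$, $\mathcal{H}_n(\mathbf{p})=\sum_{k=1}^n\frac{\operatorname{sgn}(p_1)^k}{k^{|p_1|}}\frac{\binom{n}{k}}{\binom{n+k}{k}}H_{k-1}(p_2,\dots,p_m)$. -}

module Defs where

open import Data.Nat as ℕ using (ℕ; zero; suc)
open import Data.Integer as ℤ using (ℤ; +_; -[1+_])
open import Data.Rational as ℚ using (ℚ)
open import Data.List using (List; []; _∷_; _++_; map; foldr; replicate; concatMap; length)
open import Data.Nat.Combinatorics using (_C_)

sgn : ℤ → ℤ
sgn (+ zero)  = + 0
sgn (+ suc _) = + 1
sgn -[1+ _ ]  = ℤ.- (+ 1)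

_⊕_ : ℤ → ℤ → ℤ
a ⊕ b = sgn a ℤ.* b ℤ.+ sgn b ℤ.* a

-- z / d as a rational; only used with d ≥ 1 (value 0 for d = 0 is a dummy)
frac : ℤ → ℕ → ℚ
frac z zero    = ℚ.0ℚ
frac z (suc d) = z ℚ./ suc d

term : ℕ → ℤ → ℚ
term k s = frac (sgn s ℤ.^ k) (k ℕ.^ ℤ.∣ s ∣)

sumTo : ℕ → (ℕ → ℚ) → ℚ
sumTo zero    f = ℚ.0ℚ
sumTo (suc n) f = sumTo n f ℚ.+ f (suc n)

sumList : List ℚ → ℚ
sumList = foldr ℚ._+_ ℚ.0ℚ

-- H_n(s) = Σ_{n ≥ k₁ > k₂ > ... ≥ 1} ∏ sgn(s_i)^{k_i}/k_i^{|s_i|}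
H : ℕ → List ℤ → ℚ
H n []      = ℚ.1ℚ
H n (s ∷ t) = sumTo n (λ k → term k s ℚ.* H (k ℕ.∸ 1) t)

-- H*_n(s) = Σ_{n ≥ k₁ ≥ k₂ ≥ ... ≥ 1} ∏ sgn(s_i)^{k_i}/k_i^{|s_i|}
Hstar : ℕ → List ℤ → ℚ
Hstar n []      = ℚ.1ℚ
Hstar n (s ∷ t) = sumTo n (λ k → term k s ℚ.* Hstar k t)

binRatio : ℕ → ℕ → ℚ
binRatio n k = frac (+ (n C k)) ((n ℕ.+ k) C k)

-- 𝓗_n(p₁,...,p_m) (dummy value 0 for the empty index, never used)
calH : ℕ → List ℤ → ℚ
calH n []      = ℚ.0ℚ
calH n (p ∷ t) = sumTo n (λ k → term k p ℚ.* binRatio n k ℚ.* H (k ℕ.∸ 1) t)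

-- Π(s₁,...,s_m): all 2^{m-1} indices s₁ ∘ ... ∘ s_m, ∘ ∈ {",", ⊕}
mergeHead : ℤ → List ℤ → List ℤ
mergeHead x []      = x ∷ []
mergeHead x (p ∷ t) = (x ⊕ p) ∷ t

Π : List ℤ → List (List ℤ)
Π []          = [] ∷ []
Π (x ∷ [])    = (x ∷ []) ∷ []
Π (x ∷ y ∷ t) = map (x ∷_) (Π (y ∷ t)) ++ map (mergeHead x) (Π (y ∷ t))

-- s = ({2}^{a₁},1,...,{2}^{a_r},1,{2}^{a_{r+1}})  (as = a₁..a_r, last = a_{r+1})
sIndex : List ℕ → ℕ → List ℤ
sIndex as last = concatMap (λ a → replicate a (+ 2) ++ (+ 1 ∷ [])) as ++ replicate last (+ 2)

piArgs : List ℕ → ℕ → List ℤ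
piArgs as last = map (λ a → + (2 ℕ.* a ℕ.+ 1)) as ++ (ℤ.- (+ (2 ℕ.* last)) ∷ [])

rhs : ℕ → List ℕ → ℕ → ℚ
rhs n as last = ℚ.- sumList (map (λ p → frac (+ (2 ℕ.^ length p)) 1 ℚ.* calH n p) (Π (piArgs as last)))

{-# OPTIONS --safe #-}
module Submission where

-- Write N = n + 1 and c(n,k) = binom(n,k) / binom(n+k,k).  Both sides vanish at n = 0, and
-- after multiplication by N² they satisfy the same recurrence in n.  On the left, the summands
-- with k₁ = N give N² H*_N(2,s′) = N² H*_n(2,s′) + H*_N(s′) and
-- N² H*_N(1,s′) = N² H*_n(1,s′) + N H*_N(s′).  On the right, the identity
-- N² c(N,k) = N² c(n,k) + k² c(N,k) gives N² 𝓗_N(p) = N² 𝓗_n(p) + 𝓗_N(p′), where p′ is p with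
-- |p₁| lowered by 2; this mirrors a leading 2 of s (the first argument 2a+3 of Π becomes 2a+1,
-- or −(2b+4) becomes −(2b+2)).  A leading 1 of s corresponds to the choice between p₁ = 1 and
-- p₁ = 1 ⊕ p₂ in Π; these two contributions recombine into N 𝓗_N(p₂,…) by summation by parts
-- against the weights (N − k) c(N,k).  The base case s = (2) rests on the telescoping identity
-- 2 Σ_{k=1}^{N} (−1)^k c(N,k) = −1 against the same weights.

open import Algebra.Bundles using (CommutativeMonoid)
open import Data.Empty using (⊥-elim)
open import Data.Integer as ℤ using (ℤ; +_; +[1+_]; -[1+_])
import Data.Integer.Properties as ℤP
open import Data.List using (List; []; _∷_; _++_; map; length)
import Data.List.Properties as ListP
open import Data.List.Relation.Unary.All as All using (All; []; _∷_)
import Data.List.Relation.Unary.All.Properties as AllP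
open import Data.Nat as ℕ using (ℕ; zero; suc; _≤_; _<_; s≤s; z≤n)
open import Data.Nat.Combinatorics using (_C_; nCk+nC[k+1]≡[n+1]C[k+1]; nC1≡n; k>n⇒nCk≡0)
import Data.Nat.Properties as ℕP
import Data.Nat.Tactic.RingSolver as ℕSolver
open import Data.Rational as ℚ using (ℚ; 0ℚ; 1ℚ)
import Data.Rational.Properties as ℚP
open import Data.Rational.Solver using (module +-*-Solver)
open import Data.Rational.Unnormalised as ℚᵘ using (mkℚᵘ; *≡*)
import Data.Rational.Unnormalised.Properties as ℚᵘP
open import Data.Unit using (tt)
open import Relation.Binary.PropositionalEquality

open import Defs

-- Binomial coefficients

module Binomial where

  open import Data.Nat using (_+_; _*_; _∸_)

  k≤n⇒nCk>0 : ∀ {n k} → k ≤ n → 0 < n C k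
  k≤n⇒nCk>0 {n}     {zero}  _         = s≤s z≤n
  k≤n⇒nCk>0 {suc n} {suc k} (s≤s k≤n) =
    subst (0 <_) (nCk+nC[k+1]≡[n+1]C[k+1] n k) (ℕP.<-≤-trans (k≤n⇒nCk>0 k≤n) (ℕP.m≤m+n _ _))

  [n+k]Ck>0 : ∀ n k → 0 < (n + k) C k
  [n+k]Ck>0 n k = k≤n⇒nCk>0 (ℕP.m≤n+m k n)

  [1+k]*[1+n]C[1+k]≡[1+n]*nCk : ∀ n k → suc k * (suc n C suc k) ≡ suc n * (n C k)
  [1+k]*[1+n]C[1+k]≡[1+n]*nCk zero    zero    = refl
  [1+k]*[1+n]C[1+k]≡[1+n]*nCk zero    (suc k) = ℕP.*-zeroʳ (suc (suc k))
  [1+k]*[1+n]C[1+k]≡[1+n]*nCk (suc n) zero    =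
    trans (ℕP.*-identityˡ _) (trans (nC1≡n (suc (suc n))) (sym (ℕP.*-identityʳ (suc (suc n)))))
  [1+k]*[1+n]C[1+k]≡[1+n]*nCk (suc n) (suc k) = begin
    suc (suc k) * (suc (suc n) C suc (suc k))
      ≡⟨ cong (suc (suc k) *_) (sym (nCk+nC[k+1]≡[n+1]C[k+1] (suc n) (suc k))) ⟩
    suc (suc k) * (X + suc n C suc (suc k))
      ≡⟨ ℕP.*-distribˡ-+ (suc (suc k)) X _ ⟩
    (X + suc k * X) + suc (suc k) * (suc n C suc (suc k))
      ≡⟨ cong₂ (λ a b → (X + a) + b) ([1+k]*[1+n]C[1+k]≡[1+n]*nCk n k)
                                     ([1+k]*[1+n]C[1+k]≡[1+n]*nCk n (suc k)) ⟩
    (X + suc n * (n C k)) + suc n * (n C suc k)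
      ≡⟨ regroup X (suc n) (n C k) (n C suc k) ⟩
    X + suc n * (n C k + n C suc k)
      ≡⟨ cong (λ a → X + suc n * a) (nCk+nC[k+1]≡[n+1]C[k+1] n k) ⟩
    suc (suc n) * X
      ∎
    where
    open ≡-Reasoning
    X = suc n C suc k
    regroup : ∀ x a b c → (x + a * b) + a * c ≡ x + a * (b + c)
    regroup = ℕSolver.solve-∀

  [1+k]*nC[1+k]≡[n∸k]*nCk : ∀ n k → suc k * (n C suc k) ≡ (n ∸ k) * (n C k)
  [1+k]*nC[1+k]≡[n∸k]*nCk n k = begin
    suc k * (n C suc k)
      ≡⟨ sym (ℕP.m+n∸m≡n (suc k * (n C k)) _) ⟩
    (suc k * (n C k) + suc k * (n C suc k)) ∸ suc k * (n C k)
      ≡⟨ cong (_∸ suc k * (n C k)) (sym (ℕP.*-distribˡ-+ (suc k) (n C k) (n C suc k))) ⟩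
    suc k * (n C k + n C suc k) ∸ suc k * (n C k)
      ≡⟨ cong (λ a → suc k * a ∸ suc k * (n C k)) (nCk+nC[k+1]≡[n+1]C[k+1] n k) ⟩
    suc k * (suc n C suc k) ∸ suc k * (n C k)
      ≡⟨ cong (_∸ suc k * (n C k)) ([1+k]*[1+n]C[1+k]≡[1+n]*nCk n k) ⟩
    suc n * (n C k) ∸ suc k * (n C k)
      ≡⟨ sym (ℕP.*-distribʳ-∸ (n C k) (suc n) (suc k)) ⟩
    (n ∸ k) * (n C k)
      ∎
    where open ≡-Reasoning

  [1+n∸k]*[1+n]Ck≡[1+n]*nCk : ∀ n k → (suc n ∸ k) * (suc n C k) ≡ suc n * (n C k)
  [1+n∸k]*[1+n]Ck≡[1+n]*nCk n zero    = refl
  [1+n∸k]*[1+n]Ck≡[1+n]*nCk n (suc k) = ℕP.*-cancelˡ-≡ _ _ (suc k) (begin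
    suc k * ((n ∸ k) * (suc n C suc k))  ≡⟨ swap (suc k) (n ∸ k) _ ⟩
    (n ∸ k) * (suc k * (suc n C suc k))  ≡⟨ cong ((n ∸ k) *_) ([1+k]*[1+n]C[1+k]≡[1+n]*nCk n k) ⟩
    (n ∸ k) * (suc n * (n C k))          ≡⟨ swap (n ∸ k) (suc n) _ ⟩
    suc n * ((n ∸ k) * (n C k))          ≡⟨ cong (suc n *_) (sym ([1+k]*nC[1+k]≡[n∸k]*nCk n k)) ⟩
    suc n * (suc k * (n C suc k))        ≡⟨ swap (suc n) (suc k) _ ⟩
    suc k * (suc n * (n C suc k))        ∎)
    where
    open ≡-Reasoning
    swap : ∀ a b c → a * (b * c) ≡ b * (a * c)
    swap = ℕSolver.solve-∀

  binRatio-step-cross : ∀ n j →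
    (n ∸ j) * (n C j) * ((n + suc j) C suc j) ≡ suc (n + j) * (n C suc j) * ((n + j) C j)
  binRatio-step-cross n j = ℕP.*-cancelˡ-≡ _ _ (suc j) (begin
    suc j * ((n ∸ j) * (n C j) * ((n + suc j) C suc j))
      ≡⟨ cong (λ m → suc j * ((n ∸ j) * (n C j) * (m C suc j))) (ℕP.+-suc n j) ⟩
    suc j * ((n ∸ j) * (n C j) * (suc (n + j) C suc j))
      ≡⟨ swap (suc j) ((n ∸ j) * (n C j)) _ ⟩
    (n ∸ j) * (n C j) * (suc j * (suc (n + j) C suc j))
      ≡⟨ cong ((n ∸ j) * (n C j) *_) ([1+k]*[1+n]C[1+k]≡[1+n]*nCk (n + j) j) ⟩
    (n ∸ j) * (n C j) * (suc (n + j) * ((n + j) C j))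
      ≡⟨ cong (_* (suc (n + j) * ((n + j) C j))) (sym ([1+k]*nC[1+k]≡[n∸k]*nCk n j)) ⟩
    suc j * (n C suc j) * (suc (n + j) * ((n + j) C j))
      ≡⟨ regroup (suc j) (n C suc j) (suc (n + j)) ((n + j) C j) ⟩
    suc j * (suc (n + j) * (n C suc j) * ((n + j) C j))
      ∎)
    where
    open ≡-Reasoning
    swap : ∀ a b c → a * (b * c) ≡ b * (a * c)
    swap = ℕSolver.solve-∀
    regroup : ∀ a b c d → a * b * (c * d) ≡ a * (c * b * d)
    regroup = ℕSolver.solve-∀

  binRatio-pred-cross : ∀ n k →
    (suc n ∸ k) * (suc n + k) * (suc n C k) * ((n + k) C k) ≡ suc n * suc n * (n C k) * ((suc n + k) C k)
  binRatio-pred-cross n k = begin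
    (suc n ∸ k) * (suc n + k) * (suc n C k) * ((n + k) C k)
      ≡⟨ regroup₁ (suc n ∸ k) (suc n + k) (suc n C k) _ ⟩
    ((suc n ∸ k) * (suc n C k)) * ((suc n + k) * ((n + k) C k))
      ≡⟨ cong₂ _*_ ([1+n∸k]*[1+n]Ck≡[1+n]*nCk n k) (sym top) ⟩
    (suc n * (n C k)) * (suc n * ((suc n + k) C k))
      ≡⟨ regroup₂ (suc n) (n C k) _ ⟩
    suc n * suc n * (n C k) * ((suc n + k) C k)
      ∎
    where
    open ≡-Reasoning
    top : suc n * ((suc n + k) C k) ≡ (suc n + k) * ((n + k) C k)
    top = trans (cong (λ m → m * ((suc n + k) C k)) (sym (ℕP.m+n∸n≡m (suc n) k)))
                ([1+n∸k]*[1+n]Ck≡[1+n]*nCk (n + k) k)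
    regroup₁ : ∀ a b c d → a * b * c * d ≡ (a * c) * (b * d)
    regroup₁ = ℕSolver.solve-∀
    regroup₂ : ∀ a b c → (a * b) * (a * c) ≡ a * a * b * c
    regroup₂ = ℕSolver.solve-∀

  n*n≡[n∸k]*[n+k]+k*k : ∀ {n k} → k ≤ n → n * n ≡ (n ∸ k) * (n + k) + k * k
  n*n≡[n∸k]*[n+k]+k*k {n} {k} k≤n = begin
    n * n                               ≡⟨ cong (λ m → m * m) (sym (ℕP.m∸n+n≡m k≤n)) ⟩
    (n ∸ k + k) * (n ∸ k + k)           ≡⟨ expand (n ∸ k) k ⟩
    (n ∸ k) * (n ∸ k + k + k) + k * k   ≡⟨ cong (λ m → (n ∸ k) * (m + k) + k * k) (ℕP.m∸n+n≡m k≤n) ⟩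
    (n ∸ k) * (n + k) + k * k           ∎
    where
    open ≡-Reasoning
    expand : ∀ a b → (a + b) * (a + b) ≡ a * (a + b + b) + b * b
    expand = ℕSolver.solve-∀

open Binomial

open import Data.Rational using (_+_; _*_; _-_; -_)
open import Algebra.Properties.CommutativeSemigroup (CommutativeMonoid.commutativeSemigroup ℚP.+-0-commutativeMonoid)
  using () renaming (interchange to +-interchange)
open +-*-Solver using (solve; _:+_; _:*_; _:-_; :-_; con; _:=_)

-- Embedding ℕ into ℚ

fromℚᵘ-homo-+ : ∀ p q → ℚ.fromℚᵘ (p ℚᵘ.+ q) ≡ ℚ.fromℚᵘ p + ℚ.fromℚᵘ q
fromℚᵘ-homo-+ p q = ℚP.toℚᵘ-injective (ℚᵘP.≃-sym (ℚᵘP.≃-trans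
  (ℚP.toℚᵘ-homo-+ (ℚ.fromℚᵘ p) (ℚ.fromℚᵘ q))
  (ℚᵘP.≃-trans (ℚᵘP.+-cong (ℚP.toℚᵘ-fromℚᵘ p) (ℚP.toℚᵘ-fromℚᵘ q)) (ℚᵘP.≃-sym (ℚP.toℚᵘ-fromℚᵘ _)))))

fromℚᵘ-homo-* : ∀ p q → ℚ.fromℚᵘ (p ℚᵘ.* q) ≡ ℚ.fromℚᵘ p * ℚ.fromℚᵘ q
fromℚᵘ-homo-* p q = ℚP.toℚᵘ-injective (ℚᵘP.≃-sym (ℚᵘP.≃-trans
  (ℚP.toℚᵘ-homo-* (ℚ.fromℚᵘ p) (ℚ.fromℚᵘ q))
  (ℚᵘP.≃-trans (ℚᵘP.*-cong (ℚP.toℚᵘ-fromℚᵘ p) (ℚP.toℚᵘ-fromℚᵘ q)) (ℚᵘP.≃-sym (ℚP.toℚᵘ-fromℚᵘ _)))))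

fromℚᵘ-cross : ∀ p q → ℚᵘ.↥ p ℤ.* ℚᵘ.↧ q ≡ ℚᵘ.↥ q ℤ.* ℚᵘ.↧ p → ℚ.fromℚᵘ p ≡ ℚ.fromℚᵘ q
fromℚᵘ-cross p q eq = ℚP.fromℚᵘ-cong {p} {q} (*≡* eq)

ι : ℕ → ℚ
ι m = frac (+ m) 1

ι-+ : ∀ a b → ι (a ℕ.+ b) ≡ ι a + ι b
ι-+ a b = trans (fromℚᵘ-cross (mkℚᵘ (+ (a ℕ.+ b)) 0) (mkℚᵘ (+ a) 0 ℚᵘ.+ mkℚᵘ (+ b) 0) eq)
                (fromℚᵘ-homo-+ (mkℚᵘ (+ a) 0) (mkℚᵘ (+ b) 0))
  where
  eq : + (a ℕ.+ b) ℤ.* + 1 ≡ (+ a ℤ.* + 1 ℤ.+ + b ℤ.* + 1) ℤ.* + 1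
  eq = cong (ℤ._* + 1) (trans (ℤP.pos-+ a b) (sym (cong₂ ℤ._+_ (ℤP.*-identityʳ (+ a)) (ℤP.*-identityʳ (+ b)))))

ι-* : ∀ a b → ι (a ℕ.* b) ≡ ι a * ι b
ι-* a b = trans (fromℚᵘ-cross (mkℚᵘ (+ (a ℕ.* b)) 0) (mkℚᵘ (+ a) 0 ℚᵘ.* mkℚᵘ (+ b) 0)
                                (cong (ℤ._* + 1) (ℤP.pos-* a b)))
                (fromℚᵘ-homo-* (mkℚᵘ (+ a) 0) (mkℚᵘ (+ b) 0))

ι-^2 : ∀ a → ι (a ℕ.^ 2) ≡ ι a * ι a
ι-^2 a = trans (cong ι (cong (a ℕ.*_) (ℕP.*-identityʳ a))) (ι-* a a)

ι-∸ : ∀ {m j} → j ≤ m → ι (m ℕ.∸ j) ≡ ι m - ι j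
ι-∸ {m} {j} j≤m = trans (add-sub (ι (m ℕ.∸ j)) (ι j))
  (cong (_- ι j) (trans (sym (ι-+ (m ℕ.∸ j) j)) (cong ι (ℕP.m∸n+n≡m j≤m))))
  where
  add-sub : ∀ a b → a ≡ (a + b) - b
  add-sub = solve 2 (λ a b → a := (a :+ b) :- b) refl

frac-neg : ∀ z → frac (ℤ.- z) 1 ≡ - frac z 1
frac-neg z = ℚP.toℚᵘ-injective (ℚᵘP.≃-sym (ℚᵘP.≃-trans (ℚP.toℚᵘ-homo‿- (frac z 1))
  (ℚᵘP.≃-trans (ℚᵘP.-‿cong (ℚP.toℚᵘ-fromℚᵘ (mkℚᵘ z 0))) (ℚᵘP.≃-sym (ℚP.toℚᵘ-fromℚᵘ (mkℚᵘ (ℤ.- z) 0))))))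

frac-zero : ∀ {D} → 0 < D → frac (+ 0) D ≡ 0ℚ
frac-zero {suc d} _ = ℚP.0/n≡0 (suc d)

frac-*-ι : ∀ z {D} → 0 < D → frac z D * ι D ≡ frac z 1
frac-*-ι z {suc d} _ = trans (sym (fromℚᵘ-homo-* (mkℚᵘ z d) (mkℚᵘ (+ suc d) 0)))
                             (fromℚᵘ-cross (mkℚᵘ z d ℚᵘ.* mkℚᵘ (+ suc d) 0) (mkℚᵘ z 0) eq)
  where
  eq : (z ℤ.* + suc d) ℤ.* + 1 ≡ z ℤ.* (+ (suc d ℕ.* 1))
  eq rewrite ℕP.*-identityʳ (suc d) = ℤP.*-identityʳ _

ι-cancelˡ : ∀ {d} x y → 0 < d → ι d * x ≡ ι d * y → x ≡ y
ι-cancelˡ {d} x y 0<d eq = begin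
  x                 ≡⟨ sym (ℚP.*-identityˡ x) ⟩
  1ℚ * x            ≡⟨ cong (_* x) (sym (frac-*-ι (+ 1) 0<d)) ⟩
  d⁻¹ * ι d * x     ≡⟨ ℚP.*-assoc d⁻¹ (ι d) x ⟩
  d⁻¹ * (ι d * x)   ≡⟨ cong (d⁻¹ *_) eq ⟩
  d⁻¹ * (ι d * y)   ≡⟨ sym (ℚP.*-assoc d⁻¹ (ι d) y) ⟩
  d⁻¹ * ι d * y     ≡⟨ cong (_* y) (frac-*-ι (+ 1) 0<d) ⟩
  1ℚ * y            ≡⟨ ℚP.*-identityˡ y ⟩
  y                 ∎
  where
  open ≡-Reasoning
  d⁻¹ = frac (+ 1) d

ι-*-frac-cancel : ∀ z {a D} → 0 < a → 0 < D → ι a * frac z (a ℕ.* D) ≡ frac z D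
ι-*-frac-cancel z {a} {D} 0<a 0<D = ι-cancelˡ _ _ 0<D (begin
  ι D * (ι a * frac z (a ℕ.* D))   ≡⟨ swap (ι D) (ι a) _ ⟩
  frac z (a ℕ.* D) * (ι a * ι D)   ≡⟨ cong (frac z (a ℕ.* D) *_) (sym (ι-* a D)) ⟩
  frac z (a ℕ.* D) * ι (a ℕ.* D)   ≡⟨ frac-*-ι z (ℕP.*-mono-< 0<a 0<D) ⟩
  frac z 1                         ≡⟨ sym (frac-*-ι z 0<D) ⟩
  frac z D * ι D                   ≡⟨ ℚP.*-comm _ (ι D) ⟩
  ι D * frac z D                   ∎)
  where
  open ≡-Reasoning
  swap : ∀ d a f → d * (a * f) ≡ f * (a * d)
  swap = solve 3 (λ d a f → d :* (a :* f) := f :* (a :* d)) refl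

ι-^-*-frac : ∀ z {k} w e → 0 < k → ι (k ℕ.^ w) * frac z (k ℕ.^ (w ℕ.+ e)) ≡ frac z (k ℕ.^ e)
ι-^-*-frac z {suc a} w e _ = subst (λ D → ι (suc a ℕ.^ w) * frac z D ≡ frac z (suc a ℕ.^ e))
  (sym (ℕP.^-distribˡ-+-* (suc a) w e)) (ι-*-frac-cancel z (ℕP.m^n>0 (suc a) w) (ℕP.m^n>0 (suc a) e))

-- Finite sums

sumTo-cong : ∀ n {f g : ℕ → ℚ} → (∀ k → 0 < k → k ≤ n → f k ≡ g k) → sumTo n f ≡ sumTo n g
sumTo-cong zero    f≗g = refl
sumTo-cong (suc n) f≗g =
  cong₂ _+_ (sumTo-cong n (λ k 0<k k≤n → f≗g k 0<k (ℕP.m≤n⇒m≤1+n k≤n))) (f≗g (suc n) (s≤s z≤n) ℕP.≤-refl)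

sumTo-+ : ∀ n (f g : ℕ → ℚ) → sumTo n (λ k → f k + g k) ≡ sumTo n f + sumTo n g
sumTo-+ zero    f g = refl
sumTo-+ (suc n) f g = trans (cong (_+ (f (suc n) + g (suc n))) (sumTo-+ n f g))
  (+-interchange (sumTo n f) (sumTo n g) (f (suc n)) (g (suc n)))

sumTo-* : ∀ n a (f : ℕ → ℚ) → sumTo n (λ k → a * f k) ≡ a * sumTo n f
sumTo-* zero    a f = sym (ℚP.*-zeroʳ a)
sumTo-* (suc n) a f = trans (cong (_+ a * f (suc n)) (sumTo-* n a f)) (sym (ℚP.*-distribˡ-+ a _ _))

sumTo-by-parts : ∀ (E f : ℕ → ℚ) m →
  sumTo m (λ k → (E (k ℕ.∸ 1) - E k) * sumTo (k ℕ.∸ 1) f) ≡ sumTo m (λ k → E k * f k) - E m * sumTo m f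
sumTo-by-parts E f zero    = sym (trans (cong (λ x → 0ℚ - x) (ℚP.*-zeroʳ (E 0))) (ℚP.+-inverseʳ 0ℚ))
sumTo-by-parts E f (suc m) =
  trans (cong (_+ (E m - E (suc m)) * sumTo m f) (sumTo-by-parts E f m))
        (step (sumTo m (λ k → E k * f k)) (E m) (E (suc m)) (sumTo m f) (f (suc m)))
  where
  step : ∀ S e e′ F x → (S - e * F) + (e - e′) * F ≡ (S + e′ * x) - e′ * (F + x)
  step = solve 5 (λ S e e′ F x → (S :- e :* F) :+ (e :- e′) :* F := (S :+ e′ :* x) :- e′ :* (F :+ x)) refl

sign^ : ℕ → ℚ
sign^ k = frac ((ℤ.- (+ 1)) ℤ.^ k) 1

sumTo-alternating-telescope : ∀ (E : ℕ → ℚ) m →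
  sumTo m (λ k → sign^ k * (E (k ℕ.∸ 1) + E k)) ≡ sign^ m * E m - E 0
sumTo-alternating-telescope E zero    = sym (trans (cong (_- E 0) (ℚP.*-identityˡ (E 0))) (ℚP.+-inverseʳ (E 0)))
sumTo-alternating-telescope E (suc m) = begin
  sumTo m (λ k → sign^ k * (E (k ℕ.∸ 1) + E k)) + sign^ (suc m) * (E m + E (suc m))
    ≡⟨ cong (_+ sign^ (suc m) * (E m + E (suc m))) (sumTo-alternating-telescope E m) ⟩
  (sign^ m * E m - E 0) + sign^ (suc m) * (E m + E (suc m))
    ≡⟨ cong (λ s → (sign^ m * E m - E 0) + s * (E m + E (suc m))) flip ⟩
  (sign^ m * E m - E 0) + - sign^ m * (E m + E (suc m))
    ≡⟨ step (sign^ m) (E m) (E (suc m)) (E 0) ⟩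
  - sign^ m * E (suc m) - E 0
    ≡⟨ cong (λ s → s * E (suc m) - E 0) (sym flip) ⟩
  sign^ (suc m) * E (suc m) - E 0
    ∎
  where
  open ≡-Reasoning
  flip : sign^ (suc m) ≡ - sign^ m
  flip = trans (cong (λ z → frac z 1) (ℤP.-1*i≡-i ((ℤ.- (+ 1)) ℤ.^ m))) (frac-neg ((ℤ.- (+ 1)) ℤ.^ m))
  step : ∀ s e e′ e₀ → (s * e - e₀) + - s * (e + e′) ≡ - s * e′ - e₀
  step = solve 4 (λ s e e′ e₀ → (s :* e :- e₀) :+ :- s :* (e :+ e′) := :- s :* e′ :- e₀) refl

sumOf : ∀ {A : Set} → (A → ℚ) → List A → ℚ
sumOf f xs = sumList (map f xs)

sumOf-++ : ∀ {A : Set} (f : A → ℚ) xs ys → sumOf f (xs ++ ys) ≡ sumOf f xs + sumOf f ys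
sumOf-++ f []       ys = sym (ℚP.+-identityˡ _)
sumOf-++ f (x ∷ xs) ys = trans (cong (λ s → f x + s) (sumOf-++ f xs ys)) (sym (ℚP.+-assoc (f x) _ _))

sumOf-map : ∀ {A B : Set} (f : B → ℚ) (h : A → B) xs → sumOf f (map h xs) ≡ sumOf (λ x → f (h x)) xs
sumOf-map f h xs = cong sumList (sym (ListP.map-∘ xs))

sumOf-+ : ∀ {A : Set} (f g : A → ℚ) xs → sumOf (λ x → f x + g x) xs ≡ sumOf f xs + sumOf g xs
sumOf-+ f g []       = refl
sumOf-+ f g (x ∷ xs) = trans (cong (λ s → f x + g x + s) (sumOf-+ f g xs))
  (+-interchange (f x) (g x) (sumOf f xs) (sumOf g xs))

sumOf-* : ∀ {A : Set} a (f : A → ℚ) xs → sumOf (λ x → a * f x) xs ≡ a * sumOf f xs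
sumOf-* a f []       = sym (ℚP.*-zeroʳ a)
sumOf-* a f (x ∷ xs) = trans (cong (λ s → a * f x + s) (sumOf-* a f xs)) (sym (ℚP.*-distribˡ-+ a _ _))

sumOf-recurrence : ∀ {A : Set} {P : A → Set} a (f g h : A → ℚ) {xs} → All P xs →
  (∀ {x} → P x → a * f x ≡ a * g x + h x) → a * sumOf f xs ≡ a * sumOf g xs + sumOf h xs
sumOf-recurrence a f g h []         step = trans (ℚP.*-zeroʳ a) (sym (trans (ℚP.+-identityʳ _) (ℚP.*-zeroʳ a)))
sumOf-recurrence a f g h {x ∷ xs} (px ∷ pxs) step = begin
  a * (f x + sumOf f xs)                          ≡⟨ ℚP.*-distribˡ-+ a (f x) _ ⟩
  a * f x + a * sumOf f xs                        ≡⟨ cong₂ _+_ (step px) (sumOf-recurrence a f g h pxs step) ⟩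
  (a * g x + h x) + (a * sumOf g xs + sumOf h xs) ≡⟨ regroup a (g x) (h x) _ _ ⟩
  a * (g x + sumOf g xs) + (h x + sumOf h xs)     ∎
  where
  open ≡-Reasoning
  regroup : ∀ a u v s r → (a * u + v) + (a * s + r) ≡ a * (u + s) + (v + r)
  regroup = solve 5 (λ a u v s r → (a :* u :+ v) :+ (a :* s :+ r) := a :* (u :+ s) :+ (v :+ r)) refl

-- The ratios binom(n,k) / binom(n+k,k)

binRatio-*-den : ∀ n k → binRatio n k * ι ((n ℕ.+ k) C k) ≡ ι (n C k)
binRatio-*-den n k = frac-*-ι (+ (n C k)) ([n+k]Ck>0 n k)

binRatio-cross : ∀ {n k m l} p q →
  p ℕ.* (n C k) ℕ.* ((m ℕ.+ l) C l) ≡ q ℕ.* (m C l) ℕ.* ((n ℕ.+ k) C k) →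
  ι p * binRatio n k ≡ ι q * binRatio m l
binRatio-cross {n} {k} {m} {l} p q eq = ι-cancelˡ _ _ (ℕP.*-mono-< ([n+k]Ck>0 n k) ([n+k]Ck>0 m l)) (begin
  ι (D₁ ℕ.* D₂) * (ι p * binRatio n k)   ≡⟨ clear n k p D₂ ⟩
  ι (p ℕ.* (n C k) ℕ.* D₂)               ≡⟨ cong ι eq ⟩
  ι (q ℕ.* (m C l) ℕ.* D₁)               ≡⟨ sym (clear m l q D₁) ⟩
  ι (D₂ ℕ.* D₁) * (ι q * binRatio m l)   ≡⟨ cong (λ d → ι d * (ι q * binRatio m l)) (ℕP.*-comm D₂ D₁) ⟩
  ι (D₁ ℕ.* D₂) * (ι q * binRatio m l)   ∎)
  where
  open ≡-Reasoning
  D₁ = (n ℕ.+ k) C k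
  D₂ = (m ℕ.+ l) C l
  regroup : ∀ d e p c → d * e * (p * c) ≡ p * (c * d) * e
  regroup = solve 4 (λ d e p c → d :* e :* (p :* c) := p :* (c :* d) :* e) refl
  clear : ∀ n k p e → ι (((n ℕ.+ k) C k) ℕ.* e) * (ι p * binRatio n k) ≡ ι (p ℕ.* (n C k) ℕ.* e)
  clear n k p e = begin
    ι (D ℕ.* e) * (ι p * binRatio n k)   ≡⟨ cong (_* (ι p * binRatio n k)) (ι-* D e) ⟩
    ι D * ι e * (ι p * binRatio n k)     ≡⟨ regroup (ι D) (ι e) (ι p) _ ⟩
    ι p * (binRatio n k * ι D) * ι e     ≡⟨ cong (λ x → ι p * x * ι e) (binRatio-*-den n k) ⟩
    ι p * ι (n C k) * ι e                ≡⟨ sym (trans (ι-* (p ℕ.* (n C k)) e) (cong (_* ι e) (ι-* p (n C k)))) ⟩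
    ι (p ℕ.* (n C k) ℕ.* e)              ∎
    where D = (n ℕ.+ k) C k

binRatio-vanish : ∀ n → binRatio n (suc n) ≡ 0ℚ
binRatio-vanish n = trans (cong (λ a → frac (+ a) ((n ℕ.+ suc n) C suc n)) (k>n⇒nCk≡0 (ℕP.n<1+n n)))
                          (frac-zero ([n+k]Ck>0 n (suc n)))

binRatio-step : ∀ n j → ι (n ℕ.∸ j) * binRatio n j ≡ ι (suc (n ℕ.+ j)) * binRatio n (suc j)
binRatio-step n j = binRatio-cross {n} {j} {n} {suc j} (n ℕ.∸ j) (suc (n ℕ.+ j)) (binRatio-step-cross n j)

binRatio-recurrence : ∀ n k → k ≤ suc n →
  ι (suc n) * ι (suc n) * binRatio (suc n) k ≡ ι (suc n) * ι (suc n) * binRatio n k + ι k * ι k * binRatio (suc n) k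
binRatio-recurrence n k k≤N = begin
  ι N * ι N * binRatio N k
    ≡⟨ cong (_* binRatio N k) (sym (ι-* N N)) ⟩
  ι (N ℕ.* N) * binRatio N k
    ≡⟨ cong (λ m → ι m * binRatio N k) (n*n≡[n∸k]*[n+k]+k*k k≤N) ⟩
  ι (M ℕ.+ k ℕ.* k) * binRatio N k
    ≡⟨ cong (_* binRatio N k) (trans (ι-+ M (k ℕ.* k)) (cong (λ x → ι M + x) (ι-* k k))) ⟩
  (ι M + ι k * ι k) * binRatio N k
    ≡⟨ ℚP.*-distribʳ-+ (binRatio N k) (ι M) _ ⟩
  ι M * binRatio N k + ι k * ι k * binRatio N k
    ≡⟨ cong (_+ ι k * ι k * binRatio N k) (binRatio-cross {N} {k} {n} {k} M (N ℕ.* N) (binRatio-pred-cross n k)) ⟩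
  ι (N ℕ.* N) * binRatio n k + ι k * ι k * binRatio N k
    ≡⟨ cong (λ x → x * binRatio n k + ι k * ι k * binRatio N k) (ι-* N N) ⟩
  ι N * ι N * binRatio n k + ι k * ι k * binRatio N k
    ∎
  where
  open ≡-Reasoning
  N = suc n
  M = (N ℕ.∸ k) ℕ.* (N ℕ.+ k)

binRatioWeight : ℕ → ℕ → ℚ
binRatioWeight N k = (ι N - ι k) * binRatio N k

binRatioWeight-suc : ∀ N j → j < N → binRatioWeight N j ≡ (1ℚ + (ι N + ι j)) * binRatio N (suc j)
binRatioWeight-suc N j j<N = begin
  (ι N - ι j) * binRatio N j
    ≡⟨ cong (_* binRatio N j) (sym (ι-∸ (ℕP.<⇒≤ j<N))) ⟩
  ι (N ℕ.∸ j) * binRatio N j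
    ≡⟨ binRatio-step N j ⟩
  ι (suc (N ℕ.+ j)) * binRatio N (suc j)
    ≡⟨ cong (_* binRatio N (suc j)) (trans (ι-+ 1 (N ℕ.+ j)) (cong (λ x → 1ℚ + x) (ι-+ N j))) ⟩
  (1ℚ + (ι N + ι j)) * binRatio N (suc j)
    ∎
  where open ≡-Reasoning

binRatioWeight-top : ∀ N → binRatioWeight N N ≡ 0ℚ
binRatioWeight-top N = trans (cong (_* binRatio N N) (ℚP.+-inverseʳ (ι N))) (ℚP.*-zeroˡ (binRatio N N))

binRatioWeight-diff : ∀ N k → 0 < k → k ≤ N →
  binRatioWeight N (k ℕ.∸ 1) - binRatioWeight N k ≡ ι 2 * (ι k * binRatio N k)
binRatioWeight-diff N (suc j) _ j<N = begin
  binRatioWeight N j - (ι N - ι (suc j)) * c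
    ≡⟨ cong₂ (λ a b → a - (ι N - b) * c) (binRatioWeight-suc N j j<N) (ι-+ 1 j) ⟩
  (1ℚ + (ι N + ι j)) * c - (ι N - (1ℚ + ι j)) * c
    ≡⟨ simplify (ι N) (ι j) c ⟩
  (1ℚ + 1ℚ) * ((1ℚ + ι j) * c)
    ≡⟨ sym (cong₂ (λ a b → a * (b * c)) (ι-+ 1 1) (ι-+ 1 j)) ⟩
  ι 2 * (ι (suc j) * c)
    ∎
  where
  open ≡-Reasoning
  c = binRatio N (suc j)
  simplify : ∀ n j c → (1ℚ + (n + j)) * c - (n - (1ℚ + j)) * c ≡ (1ℚ + 1ℚ) * ((1ℚ + j) * c)
  simplify = solve 3 (λ n j c → (con 1ℚ :+ (n :+ j)) :* c :- (n :- (con 1ℚ :+ j)) :* c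
                              := (con 1ℚ :+ con 1ℚ) :* ((con 1ℚ :+ j) :* c)) refl

binRatioWeight-sum : ∀ N k → 0 < k → k ≤ N →
  binRatioWeight N (k ℕ.∸ 1) + binRatioWeight N k ≡ ι 2 * (ι N * binRatio N k)
binRatioWeight-sum N (suc j) _ j<N = begin
  binRatioWeight N j + (ι N - ι (suc j)) * c
    ≡⟨ cong₂ (λ a b → a + (ι N - b) * c) (binRatioWeight-suc N j j<N) (ι-+ 1 j) ⟩
  (1ℚ + (ι N + ι j)) * c + (ι N - (1ℚ + ι j)) * c
    ≡⟨ simplify (ι N) (ι j) c ⟩
  (1ℚ + 1ℚ) * (ι N * c)
    ≡⟨ sym (cong (λ a → a * (ι N * c)) (ι-+ 1 1)) ⟩
  ι 2 * (ι N * c)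
    ∎
  where
  open ≡-Reasoning
  c = binRatio N (suc j)
  simplify : ∀ n j c → (1ℚ + (n + j)) * c + (n - (1ℚ + j)) * c ≡ (1ℚ + 1ℚ) * (n * c)
  simplify = solve 3 (λ n j c → (con 1ℚ :+ (n :+ j)) :* c :+ (n :- (con 1ℚ :+ j)) :* c
                              := (con 1ℚ :+ con 1ℚ) :* (n :* c)) refl

sumTo-binRatio-by-parts : ∀ N (f : ℕ → ℚ) →
  ι 2 * sumTo N (λ k → ι k * binRatio N k * sumTo (k ℕ.∸ 1) f) + sumTo N (λ k → ι k * binRatio N k * f k)
    ≡ ι N * sumTo N (λ k → binRatio N k * f k)
sumTo-binRatio-by-parts N f = begin
  ι 2 * sumTo N (λ k → ι k * c k * F k) + S
    ≡⟨ cong (_+ S) (sym (sumTo-* N (ι 2) _)) ⟩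
  sumTo N (λ k → ι 2 * (ι k * c k * F k)) + S
    ≡⟨ cong (_+ S) (sumTo-cong N weights-diff) ⟩
  sumTo N (λ k → (E (k ℕ.∸ 1) - E k) * F k) + S
    ≡⟨ cong (_+ S) (sumTo-by-parts E f N) ⟩
  (sumTo N (λ k → E k * f k) - E N * sumTo N f) + S
    ≡⟨ cong (λ e → (sumTo N (λ k → E k * f k) - e * sumTo N f) + S) (binRatioWeight-top N) ⟩
  (sumTo N (λ k → E k * f k) - 0ℚ * sumTo N f) + S
    ≡⟨ cong (_+ S) (drop-zero (sumTo N (λ k → E k * f k)) (sumTo N f)) ⟩
  sumTo N (λ k → E k * f k) + S
    ≡⟨ sym (sumTo-+ N (λ k → E k * f k) (λ k → ι k * c k * f k)) ⟩
  sumTo N (λ k → E k * f k + ι k * c k * f k)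
    ≡⟨ sumTo-cong N (λ k _ _ → collect (ι N) (ι k) (c k) (f k)) ⟩
  sumTo N (λ k → ι N * (c k * f k))
    ≡⟨ sumTo-* N (ι N) (λ k → c k * f k) ⟩
  ι N * sumTo N (λ k → c k * f k)
    ∎
  where
  open ≡-Reasoning
  c = binRatio N
  E = binRatioWeight N
  F : ℕ → ℚ
  F k = sumTo (k ℕ.∸ 1) f
  S = sumTo N (λ k → ι k * c k * f k)
  weights-diff : ∀ k → 0 < k → k ≤ N → ι 2 * (ι k * c k * F k) ≡ (E (k ℕ.∸ 1) - E k) * F k
  weights-diff k 0<k k≤N =
    trans (sym (ℚP.*-assoc (ι 2) (ι k * c k) (F k))) (cong (_* F k) (sym (binRatioWeight-diff N k 0<k k≤N)))
  drop-zero : ∀ a b → a - 0ℚ * b ≡ a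
  drop-zero = solve 2 (λ a b → a :- con 0ℚ :* b := a) refl
  collect : ∀ n k c f → (n - k) * c * f + k * c * f ≡ n * (c * f)
  collect = solve 4 (λ n k c f → (n :- k) :* c :* f :+ k :* c :* f := n :* (c :* f)) refl

sumTo-binRatio-alternating : ∀ n → ι 2 * sumTo (suc n) (λ k → sign^ k * binRatio (suc n) k) ≡ - 1ℚ
sumTo-binRatio-alternating n = ι-cancelˡ {suc n} _ (- 1ℚ) (s≤s z≤n) (begin
  ι N * (ι 2 * S)                                 ≡⟨ swap (ι N) (ι 2) S ⟩
  (ι 2 * ι N) * S                                 ≡⟨ sym (sumTo-* N (ι 2 * ι N) (λ k → sign^ k * c k)) ⟩
  sumTo N (λ k → (ι 2 * ι N) * (sign^ k * c k))   ≡⟨ sumTo-cong N weights-sum ⟩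
  sumTo N (λ k → sign^ k * (E (k ℕ.∸ 1) + E k))   ≡⟨ sumTo-alternating-telescope E N ⟩
  sign^ N * E N - E 0                             ≡⟨ cong (λ e → sign^ N * e - E 0) (binRatioWeight-top N) ⟩
  sign^ N * 0ℚ - (ι N - 0ℚ) * 1ℚ                  ≡⟨ simplify (sign^ N) (ι N) ⟩
  ι N * - 1ℚ                                      ∎)
  where
  open ≡-Reasoning
  N = suc n
  c = binRatio N
  E = binRatioWeight N
  S = sumTo N (λ k → sign^ k * c k)
  swap : ∀ n t s → n * (t * s) ≡ (t * n) * s
  swap = solve 3 (λ n t s → n :* (t :* s) := (t :* n) :* s) refl
  exchange : ∀ t s c → t * (s * c) ≡ s * (t * c)
  exchange = solve 3 (λ t s c → t :* (s :* c) := s :* (t :* c)) refl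
  weights-sum : ∀ k → 0 < k → k ≤ N → (ι 2 * ι N) * (sign^ k * c k) ≡ sign^ k * (E (k ℕ.∸ 1) + E k)
  weights-sum k 0<k k≤N = trans (exchange (ι 2 * ι N) (sign^ k) (c k))
    (cong (sign^ k *_) (trans (ℚP.*-assoc (ι 2) (ι N) (c k)) (sym (binRatioWeight-sum N k 0<k k≤N))))
  simplify : ∀ s n → s * 0ℚ - (n - 0ℚ) * 1ℚ ≡ n * - 1ℚ
  simplify = solve 2 (λ s n → s :* con 0ℚ :- (n :- con 0ℚ) :* con 1ℚ := n :* :- con 1ℚ) refl

-- The terms sgn(s)^k / k^|s|

ι-^-*-term : ∀ s {k} → 0 < k → ι (k ℕ.^ ℤ.∣ s ∣) * term k s ≡ frac (sgn s ℤ.^ k) 1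
ι-^-*-term s {k} 0<k = subst (λ w → ι (k ℕ.^ ℤ.∣ s ∣) * frac (sgn s ℤ.^ k) (k ℕ.^ w) ≡ frac (sgn s ℤ.^ k) 1)
  (ℕP.+-identityʳ ℤ.∣ s ∣) (ι-^-*-frac (sgn s ℤ.^ k) ℤ.∣ s ∣ 0 0<k)

ι-*-term-1 : ∀ {k} → 0 < k → ι k * term k (+ 1) ≡ 1ℚ
ι-*-term-1 {k} 0<k = begin
  ι k * term k (+ 1)          ≡⟨ cong (λ m → ι m * term k (+ 1)) (sym (ℕP.^-identityʳ k)) ⟩
  ι (k ℕ.^ 1) * term k (+ 1)  ≡⟨ ι-^-*-term (+ 1) 0<k ⟩
  frac ((+ 1) ℤ.^ k) 1        ≡⟨ cong (λ z → frac z 1) (ℤP.^-zeroˡ k) ⟩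
  1ℚ                          ∎
  where open ≡-Reasoning

ι²-*-term-2 : ∀ {k} → 0 < k → ι k * ι k * term k (+ 2) ≡ 1ℚ
ι²-*-term-2 {k} 0<k = begin
  ι k * ι k * term k (+ 2)    ≡⟨ cong (_* term k (+ 2)) (sym (ι-^2 k)) ⟩
  ι (k ℕ.^ 2) * term k (+ 2)  ≡⟨ ι-^-*-term (+ 2) 0<k ⟩
  frac ((+ 1) ℤ.^ k) 1        ≡⟨ cong (λ z → frac z 1) (ℤP.^-zeroˡ k) ⟩
  1ℚ                          ∎
  where open ≡-Reasoning

ι²-*-term-neg2 : ∀ {k} → 0 < k → ι k * ι k * term k -[1+ 1 ] ≡ sign^ k
ι²-*-term-neg2 {k} 0<k = trans (cong (_* term k -[1+ 1 ]) (sym (ι-^2 k))) (ι-^-*-term -[1+ 1 ] 0<k)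

-- A record, rather than the bare function type, so that s and s′ can be inferred.
record TermShift (w : ℕ) (s s′ : ℤ) : Set where
  constructor term-shifts
  field shift : ∀ k → 0 < k → ι (k ℕ.^ w) * term k s ≡ term k s′

open TermShift

term-shift : ∀ {w s s′} → sgn s ≡ sgn s′ → ℤ.∣ s ∣ ≡ w ℕ.+ ℤ.∣ s′ ∣ → TermShift w s s′
term-shift {w} {s} {s′} sgn≡ ∣s∣≡ = term-shifts lower
  where
  lower : ∀ k → 0 < k → ι (k ℕ.^ w) * term k s ≡ term k s′
  lower k 0<k rewrite sgn≡ | ∣s∣≡ = ι-^-*-frac (sgn s′ ℤ.^ k) w ℤ.∣ s′ ∣ 0<k

term-shift-0 : ∀ w → TermShift w (+ 0) (+ 0)
term-shift-0 w = term-shifts λ where (suc a) _ → ℚP.*-zeroʳ (ι (suc a ℕ.^ w))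

⊕-abs : ∀ m y .{{_ : ℤ.NonZero y}} → ℤ.∣ +[1+ m ] ⊕ y ∣ ≡ suc m ℕ.+ ℤ.∣ y ∣
⊕-abs m +[1+ j ] = trans (cong ℤ.∣_∣ (cong₂ ℤ._+_ (ℤP.*-identityˡ +[1+ j ]) (ℤP.*-identityˡ +[1+ m ])))
                         (ℕP.+-comm (suc j) (suc m))
⊕-abs m -[1+ j ] = trans (cong ℤ.∣_∣ (cong₂ ℤ._+_ (ℤP.*-identityˡ -[1+ j ]) (ℤP.-1*i≡-i +[1+ m ])))
                         (cong suc (trans (cong suc (ℕP.+-comm j m)) (sym (ℕP.+-suc m j))))

⊕-abs-shift : ∀ w m y .{{_ : ℤ.NonZero y}} → ℤ.∣ +[1+ w ℕ.+ m ] ⊕ y ∣ ≡ w ℕ.+ ℤ.∣ +[1+ m ] ⊕ y ∣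
⊕-abs-shift w m y = begin
  ℤ.∣ +[1+ w ℕ.+ m ] ⊕ y ∣     ≡⟨ ⊕-abs (w ℕ.+ m) y ⟩
  suc (w ℕ.+ m) ℕ.+ ℤ.∣ y ∣    ≡⟨ cong suc (ℕP.+-assoc w m ℤ.∣ y ∣) ⟩
  suc (w ℕ.+ (m ℕ.+ ℤ.∣ y ∣))  ≡⟨ sym (ℕP.+-suc w _) ⟩
  w ℕ.+ (suc m ℕ.+ ℤ.∣ y ∣)    ≡⟨ cong (w ℕ.+_) (sym (⊕-abs m y)) ⟩
  w ℕ.+ ℤ.∣ +[1+ m ] ⊕ y ∣     ∎
  where open ≡-Reasoning

term-shift-⊕ : ∀ w m y → TermShift w (+[1+ w ℕ.+ m ] ⊕ y) (+[1+ m ] ⊕ y)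
term-shift-⊕ w m (+ zero)    = term-shift-0 w
term-shift-⊕ w m y@(+[1+ _ ]) = term-shift refl (⊕-abs-shift w m y)
term-shift-⊕ w m y@(-[1+ _ ]) = term-shift refl (⊕-abs-shift w m y)

term-shift-1⊕ : ∀ y → TermShift 1 ((+ 1) ⊕ y) y
term-shift-1⊕ (+ zero)    = term-shift-0 1
term-shift-1⊕ y@(+[1+ _ ]) = term-shift refl (⊕-abs 0 y)
term-shift-1⊕ y@(-[1+ _ ]) = term-shift refl (⊕-abs 0 y)

2[1+a]+1≡suc[2+2a] : ∀ a → 2 ℕ.* suc a ℕ.+ 1 ≡ suc (2 ℕ.+ 2 ℕ.* a)
2[1+a]+1≡suc[2+2a] = ℕSolver.solve-∀

2a+1≡suc[2a] : ∀ a → 2 ℕ.* a ℕ.+ 1 ≡ suc (2 ℕ.* a)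
2a+1≡suc[2a] = ℕSolver.solve-∀

odd-shift : ∀ a → TermShift 2 (+ (2 ℕ.* suc a ℕ.+ 1)) (+ (2 ℕ.* a ℕ.+ 1))
odd-shift a = subst₂ (λ u v → TermShift 2 (+ u) (+ v)) (sym (2[1+a]+1≡suc[2+2a] a)) (sym (2a+1≡suc[2a] a))
  (term-shift refl refl)

odd-shift-⊕ : ∀ a y → TermShift 2 ((+ (2 ℕ.* suc a ℕ.+ 1)) ⊕ y) ((+ (2 ℕ.* a ℕ.+ 1)) ⊕ y)
odd-shift-⊕ a y = subst₂ (λ u v → TermShift 2 ((+ u) ⊕ y) ((+ v) ⊕ y))
  (sym (2[1+a]+1≡suc[2+2a] a)) (sym (2a+1≡suc[2a] a)) (term-shift-⊕ 2 (2 ℕ.* a) y)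

even-shift : ∀ b → TermShift 2 (ℤ.- (+ (2 ℕ.* suc (suc b)))) (ℤ.- (+ (2 ℕ.* suc b)))
even-shift b = term-shift refl (double-suc b)
  where
  double-suc : ∀ b → 2 ℕ.* suc (suc b) ≡ 2 ℕ.+ 2 ℕ.* suc b
  double-suc = ℕSolver.solve-∀

-- Recurrences in n

Recurrence : (ℕ → ℚ) → (ℕ → ℚ) → Set
Recurrence Δ f = ∀ n → ι (suc n) * ι (suc n) * f (suc n) ≡ ι (suc n) * ι (suc n) * f n + Δ n

calH-step : ∀ x t →
  Recurrence (λ n → sumTo (suc n) (λ k → ι k * ι k * term k x * binRatio (suc n) k * H (k ℕ.∸ 1) t))
             (λ m → calH m (x ∷ t))
calH-step x t n = begin
  q * sumTo N (φ N)
    ≡⟨ sym (sumTo-* N q (φ N)) ⟩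
  sumTo N (λ k → q * φ N k)
    ≡⟨ sumTo-cong N (λ k _ k≤N → split k k≤N) ⟩
  sumTo N (λ k → q * φ n k + ψ k)
    ≡⟨ sumTo-+ N (λ k → q * φ n k) ψ ⟩
  sumTo N (λ k → q * φ n k) + sumTo N ψ
    ≡⟨ cong (_+ sumTo N ψ) (sumTo-* N q (φ n)) ⟩
  q * (sumTo n (φ n) + term N x * binRatio n N * H n t) + sumTo N ψ
    ≡⟨ cong (λ e → q * (sumTo n (φ n) + term N x * e * H n t) + sumTo N ψ) (binRatio-vanish n) ⟩
  q * (sumTo n (φ n) + term N x * 0ℚ * H n t) + sumTo N ψ
    ≡⟨ cong (λ s → q * s + sumTo N ψ) (drop-zero (sumTo n (φ n)) (term N x) (H n t)) ⟩
  q * sumTo n (φ n) + sumTo N ψ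
    ∎
  where
  open ≡-Reasoning
  N = suc n
  q = ι N * ι N
  φ : ℕ → ℕ → ℚ
  φ m k = term k x * binRatio m k * H (k ℕ.∸ 1) t
  ψ : ℕ → ℚ
  ψ k = ι k * ι k * term k x * binRatio N k * H (k ℕ.∸ 1) t
  drop-zero : ∀ s u h → s + u * 0ℚ * h ≡ s
  drop-zero = solve 3 (λ s u h → s :+ u :* con 0ℚ :* h := s) refl
  move-in : ∀ q u c h → q * (u * c * h) ≡ u * (q * c) * h
  move-in = solve 4 (λ q u c h → q :* (u :* c :* h) := u :* (q :* c) :* h) refl
  move-out : ∀ q u c kk c′ h → u * (q * c + kk * c′) * h ≡ q * (u * c * h) + kk * u * c′ * h
  move-out = solve 6 (λ q u c kk c′ h → u :* (q :* c :+ kk :* c′) :* h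
                                     := q :* (u :* c :* h) :+ kk :* u :* c′ :* h) refl
  split : ∀ k → k ≤ N → q * φ N k ≡ q * φ n k + ψ k
  split k k≤N = begin
    q * φ N k
      ≡⟨ move-in q (term k x) (binRatio N k) _ ⟩
    term k x * (q * binRatio N k) * H (k ℕ.∸ 1) t
      ≡⟨ cong (λ e → term k x * e * H (k ℕ.∸ 1) t) (binRatio-recurrence n k k≤N) ⟩
    term k x * (q * binRatio n k + ι k * ι k * binRatio N k) * H (k ℕ.∸ 1) t
      ≡⟨ move-out q (term k x) (binRatio n k) (ι k * ι k) _ _ ⟩
    q * φ n k + ψ k
      ∎

calH-shrink : ∀ {x x′} t → TermShift 2 x x′ → Recurrence (λ n → calH (suc n) (x′ ∷ t)) (λ m → calH m (x ∷ t))
calH-shrink {x} {x′} t x→x′ n =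
  trans (calH-step x t n) (cong (λ s → ι (suc n) * ι (suc n) * calH n (x ∷ t) + s) (sumTo-cong (suc n) lower))
  where
  lower : ∀ k → 0 < k → k ≤ suc n →
    ι k * ι k * term k x * binRatio (suc n) k * H (k ℕ.∸ 1) t ≡ term k x′ * binRatio (suc n) k * H (k ℕ.∸ 1) t
  lower k 0<k _ = cong (λ u → u * binRatio (suc n) k * H (k ℕ.∸ 1) t)
    (trans (cong (_* term k x) (sym (ι-^2 k))) (shift x→x′ k 0<k))

calH-merge : ∀ y t →
  Recurrence (λ n → ι (suc n) * calH (suc n) (y ∷ t))
             (λ m → ι 2 * calH m (+ 1 ∷ y ∷ t) + calH m ((+ 1) ⊕ y ∷ t))
calH-merge y t n = begin
  q * (ι 2 * A + B)
    ≡⟨ distrib q (ι 2) A B ⟩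
  ι 2 * (q * A) + q * B
    ≡⟨ cong₂ (λ a b → ι 2 * a + b) (calH-step (+ 1) (y ∷ t) n) (calH-step ((+ 1) ⊕ y) t n) ⟩
  ι 2 * (q * A′ + S₁) + (q * B′ + S₂)
    ≡⟨ regroup q (ι 2) A′ B′ S₁ S₂ ⟩
  q * (ι 2 * A′ + B′) + (ι 2 * S₁ + S₂)
    ≡⟨ cong (λ s → q * (ι 2 * A′ + B′) + s) merge ⟩
  q * (ι 2 * A′ + B′) + ι N * C
    ∎
  where
  open ≡-Reasoning
  N = suc n
  q = ι N * ι N
  A = calH N (+ 1 ∷ y ∷ t)
  A′ = calH n (+ 1 ∷ y ∷ t)
  B = calH N ((+ 1) ⊕ y ∷ t)
  B′ = calH n ((+ 1) ⊕ y ∷ t)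
  C = calH N (y ∷ t)
  c = binRatio N
  f : ℕ → ℚ
  f j = term j y * H (j ℕ.∸ 1) t
  S₁ = sumTo N (λ k → ι k * ι k * term k (+ 1) * c k * H (k ℕ.∸ 1) (y ∷ t))
  S₂ = sumTo N (λ k → ι k * ι k * term k ((+ 1) ⊕ y) * c k * H (k ℕ.∸ 1) t)
  distrib : ∀ q t a b → q * (t * a + b) ≡ t * (q * a) + q * b
  distrib = solve 4 (λ q t a b → q :* (t :* a :+ b) := t :* (q :* a) :+ q :* b) refl
  regroup : ∀ q t a b s s′ → t * (q * a + s) + (q * b + s′) ≡ q * (t * a + b) + (t * s + s′)
  regroup = solve 6 (λ q t a b s s′ → t :* (q :* a :+ s) :+ (q :* b :+ s′)
                                    := q :* (t :* a :+ b) :+ (t :* s :+ s′)) refl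
  regroup′ : ∀ k u c h → k * k * u * c * h ≡ k * c * (k * u * h)
  regroup′ = solve 4 (λ k u c h → k :* k :* u :* c :* h := k :* c :* (k :* u :* h)) refl
  swap : ∀ c u h → c * (u * h) ≡ u * c * h
  swap = solve 3 (λ c u h → c :* (u :* h) := u :* c :* h) refl
  S₁≡ : S₁ ≡ sumTo N (λ k → ι k * c k * sumTo (k ℕ.∸ 1) f)
  S₁≡ = sumTo-cong N λ k 0<k _ → trans (regroup′ (ι k) (term k (+ 1)) (c k) _)
    (cong (ι k * c k *_) (trans (cong (_* H (k ℕ.∸ 1) (y ∷ t)) (ι-*-term-1 0<k)) (ℚP.*-identityˡ _)))
  ι-*-term-1⊕ : ∀ k → 0 < k → ι k * term k ((+ 1) ⊕ y) ≡ term k y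
  ι-*-term-1⊕ k 0<k =
    trans (cong (λ m → ι m * term k ((+ 1) ⊕ y)) (sym (ℕP.^-identityʳ k))) (shift (term-shift-1⊕ y) k 0<k)
  S₂≡ : S₂ ≡ sumTo N (λ k → ι k * c k * f k)
  S₂≡ = sumTo-cong N λ k 0<k _ → trans (regroup′ (ι k) (term k ((+ 1) ⊕ y)) (c k) _)
    (cong (λ u → ι k * c k * (u * H (k ℕ.∸ 1) t)) (ι-*-term-1⊕ k 0<k))
  merge : ι 2 * S₁ + S₂ ≡ ι N * C
  merge = begin
    ι 2 * S₁ + S₂
      ≡⟨ cong₂ (λ a b → ι 2 * a + b) S₁≡ S₂≡ ⟩
    ι 2 * sumTo N (λ k → ι k * c k * sumTo (k ℕ.∸ 1) f) + sumTo N (λ k → ι k * c k * f k)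
      ≡⟨ sumTo-binRatio-by-parts N f ⟩
    ι N * sumTo N (λ k → c k * f k)
      ≡⟨ cong (ι N *_) (sumTo-cong N λ k _ _ → swap (c k) (term k y) (H (k ℕ.∸ 1) t)) ⟩
    ι N * C
      ∎

sumOf-Π-∷ : ∀ (f : List ℤ → ℚ) x y t →
  sumOf f (Π (x ∷ y ∷ t)) ≡ sumOf (λ p → f (x ∷ p) + f (mergeHead x p)) (Π (y ∷ t))
sumOf-Π-∷ f x y t = begin
  sumOf f (map (x ∷_) P ++ map (mergeHead x) P)
    ≡⟨ sumOf-++ f (map (x ∷_) P) _ ⟩
  sumOf f (map (x ∷_) P) + sumOf f (map (mergeHead x) P)
    ≡⟨ cong₂ _+_ (sumOf-map f (x ∷_) P) (sumOf-map f (mergeHead x) P) ⟩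
  sumOf (λ p → f (x ∷ p)) P + sumOf (λ p → f (mergeHead x p)) P
    ≡⟨ sym (sumOf-+ (λ p → f (x ∷ p)) (λ p → f (mergeHead x p)) P) ⟩
  sumOf (λ p → f (x ∷ p) + f (mergeHead x p)) P
    ∎
  where
  open ≡-Reasoning
  P = Π (y ∷ t)

Π-nonempty : ∀ x R → All (_≢ []) (Π (x ∷ R))
Π-nonempty x []      = (λ ()) ∷ []
Π-nonempty x (y ∷ t) = AllP.++⁺ (AllP.map⁺ {f = x ∷_} (All.universal (λ _ ()) (Π (y ∷ t))))
                                (AllP.map⁺ {f = mergeHead x} (All.universal mergeHead-nonempty (Π (y ∷ t))))
  where
  mergeHead-nonempty : ∀ p → mergeHead x p ≢ []
  mergeHead-nonempty []      ()
  mergeHead-nonempty (_ ∷ _) ()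

weighted : ℕ → List ℤ → ℚ
weighted m p = ι (2 ℕ.^ length p) * calH m p

Φ : ℕ → List ℤ → ℚ
Φ m s = sumOf (weighted m) (Π s)

Φ-zero : ∀ s → Φ 0 s ≡ 0ℚ
Φ-zero s = vanish (Π s)
  where
  weighted-zero : ∀ p → weighted 0 p ≡ 0ℚ
  weighted-zero []      = ℚP.*-zeroʳ (ι 1)
  weighted-zero (_ ∷ p) = ℚP.*-zeroʳ (ι (2 ℕ.^ suc (length p)))
  vanish : ∀ ps → sumOf (weighted 0) ps ≡ 0ℚ
  vanish []       = refl
  vanish (p ∷ ps) = trans (cong₂ _+_ (weighted-zero p) (vanish ps)) (ℚP.+-identityˡ 0ℚ)

weighted-shrink : ∀ {x x′} t → TermShift 2 x x′ →
  Recurrence (λ n → weighted (suc n) (x′ ∷ t)) (λ m → weighted m (x ∷ t))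
weighted-shrink {x} {x′} t x→x′ n = begin
  q * (w * calH N (x ∷ t))                         ≡⟨ swap q w _ ⟩
  w * (q * calH N (x ∷ t))                         ≡⟨ cong (w *_) (calH-shrink t x→x′ n) ⟩
  w * (q * calH n (x ∷ t) + calH N (x′ ∷ t))       ≡⟨ distrib q w _ _ ⟩
  q * (w * calH n (x ∷ t)) + w * calH N (x′ ∷ t)   ∎
  where
  open ≡-Reasoning
  N = suc n
  q = ι N * ι N
  w = ι (2 ℕ.^ suc (length t))
  swap : ∀ q w a → q * (w * a) ≡ w * (q * a)
  swap = solve 3 (λ q w a → q :* (w :* a) := w :* (q :* a)) refl
  distrib : ∀ q w a b → w * (q * a + b) ≡ q * (w * a) + w * b
  distrib = solve 4 (λ q w a b → w :* (q :* a :+ b) := q :* (w :* a) :+ w :* b) refl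

weighted-merge : ∀ y t →
  Recurrence (λ n → ι (suc n) * weighted (suc n) (y ∷ t))
             (λ m → weighted m (+ 1 ∷ y ∷ t) + weighted m (mergeHead (+ 1) (y ∷ t)))
weighted-merge y t n = begin
  q * (ι (2 ℕ.* L) * A + w * B)
    ≡⟨ cong (λ u → q * (u * A + w * B)) (ι-* 2 L) ⟩
  q * (ι 2 * w * A + w * B)
    ≡⟨ factor q (ι 2) w A B ⟩
  w * (q * (ι 2 * A + B))
    ≡⟨ cong (w *_) (calH-merge y t n) ⟩
  w * (q * (ι 2 * A′ + B′) + ι N * C)
    ≡⟨ unfactor q (ι 2) w A′ B′ (ι N) C ⟩
  q * (ι 2 * w * A′ + w * B′) + ι N * (w * C)
    ≡⟨ cong (λ u → q * (u * A′ + w * B′) + ι N * (w * C)) (sym (ι-* 2 L)) ⟩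
  q * (ι (2 ℕ.* L) * A′ + w * B′) + ι N * (w * C)
    ∎
  where
  open ≡-Reasoning
  N = suc n
  q = ι N * ι N
  L = 2 ℕ.^ length (y ∷ t)
  w = ι L
  A = calH N (+ 1 ∷ y ∷ t)
  A′ = calH n (+ 1 ∷ y ∷ t)
  B = calH N ((+ 1) ⊕ y ∷ t)
  B′ = calH n ((+ 1) ⊕ y ∷ t)
  C = calH N (y ∷ t)
  factor : ∀ q t w a b → q * (t * w * a + w * b) ≡ w * (q * (t * a + b))
  factor = solve 5 (λ q t w a b → q :* (t :* w :* a :+ w :* b) := w :* (q :* (t :* a :+ b))) refl
  unfactor : ∀ q t w a b n c → w * (q * (t * a + b) + n * c) ≡ q * (t * w * a + w * b) + n * (w * c)
  unfactor = solve 7 (λ q t w a b n c → w :* (q :* (t :* a :+ b) :+ n :* c)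
                                     := q :* (t :* w :* a :+ w :* b) :+ n :* (w :* c)) refl

Φ-shrink-[] : ∀ {x x′} → TermShift 2 x x′ → Recurrence (λ n → Φ (suc n) (x′ ∷ [])) (λ m → Φ m (x ∷ []))
Φ-shrink-[] {x} {x′} x→x′ n = begin
  q * (weighted N (x ∷ []) + 0ℚ)
    ≡⟨ cong (q *_) (ℚP.+-identityʳ _) ⟩
  q * weighted N (x ∷ [])
    ≡⟨ weighted-shrink [] x→x′ n ⟩
  q * weighted n (x ∷ []) + weighted N (x′ ∷ [])
    ≡⟨ sym (cong₂ (λ a b → q * a + b) (ℚP.+-identityʳ _) (ℚP.+-identityʳ _)) ⟩
  q * (weighted n (x ∷ []) + 0ℚ) + (weighted N (x′ ∷ []) + 0ℚ)
    ∎
  where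
  open ≡-Reasoning
  N = suc n
  q = ι N * ι N

Φ-shrink : ∀ {x x′} → TermShift 2 x x′ → (∀ y → TermShift 2 (x ⊕ y) (x′ ⊕ y)) →
  ∀ R → Recurrence (λ n → Φ (suc n) (x′ ∷ R)) (λ m → Φ m (x ∷ R))
Φ-shrink x→x′ x⊕→x′⊕ []      = Φ-shrink-[] x→x′
Φ-shrink {x} {x′} x→x′ x⊕→x′⊕ (y ∷ t) n = begin
  q * Φ N (x ∷ y ∷ t)
    ≡⟨ cong (q *_) (sumOf-Π-∷ (weighted N) x y t) ⟩
  q * sumOf (pair N x) P
    ≡⟨ sumOf-recurrence q (pair N x) (pair n x) (pair N x′) (All.universal (λ _ → tt) P) (λ {p} _ → step p) ⟩
  q * sumOf (pair n x) P + sumOf (pair N x′) P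
    ≡⟨ sym (cong₂ (λ a b → q * a + b) (sumOf-Π-∷ (weighted n) x y t) (sumOf-Π-∷ (weighted N) x′ y t)) ⟩
  q * Φ n (x ∷ y ∷ t) + Φ N (x′ ∷ y ∷ t)
    ∎
  where
  open ≡-Reasoning
  N = suc n
  q = ι N * ι N
  P = Π (y ∷ t)
  pair : ℕ → ℤ → List ℤ → ℚ
  pair m h p = weighted m (h ∷ p) + weighted m (mergeHead h p)
  merged : ∀ p → q * weighted N (mergeHead x p) ≡ q * weighted n (mergeHead x p) + weighted N (mergeHead x′ p)
  merged []      = weighted-shrink [] x→x′ n
  merged (z ∷ u) = weighted-shrink u (x⊕→x′⊕ z) n
  regroup : ∀ q a b c d → (q * a + b) + (q * c + d) ≡ q * (a + c) + (b + d)
  regroup = solve 5 (λ q a b c d → (q :* a :+ b) :+ (q :* c :+ d) := q :* (a :+ c) :+ (b :+ d)) refl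
  step : ∀ p → q * pair N x p ≡ q * pair n x p + pair N x′ p
  step p = trans (ℚP.*-distribˡ-+ q _ _)
    (trans (cong₂ _+_ (weighted-shrink p x→x′ n) (merged p)) (regroup q _ _ _ _))

Φ-merge : ∀ y t → Recurrence (λ n → ι (suc n) * Φ (suc n) (y ∷ t)) (λ m → Φ m (+ 1 ∷ y ∷ t))
Φ-merge y t n = begin
  q * Φ N (+ 1 ∷ y ∷ t)
    ≡⟨ cong (q *_) (sumOf-Π-∷ (weighted N) (+ 1) y t) ⟩
  q * sumOf (pair N) P
    ≡⟨ sumOf-recurrence q (pair N) (pair n) (λ p → ι N * weighted N p) (Π-nonempty y t) step ⟩
  q * sumOf (pair n) P + sumOf (λ p → ι N * weighted N p) P
    ≡⟨ cong₂ (λ a b → q * a + b) (sym (sumOf-Π-∷ (weighted n) (+ 1) y t)) (sumOf-* (ι N) (weighted N) P) ⟩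
  q * Φ n (+ 1 ∷ y ∷ t) + ι N * Φ N (y ∷ t)
    ∎
  where
  open ≡-Reasoning
  N = suc n
  q = ι N * ι N
  P = Π (y ∷ t)
  pair : ℕ → List ℤ → ℚ
  pair m p = weighted m (+ 1 ∷ p) + weighted m (mergeHead (+ 1) p)
  step : ∀ {p} → p ≢ [] → q * pair N p ≡ q * pair n p + ι N * weighted N p
  step {[]}    []≢[] = ⊥-elim ([]≢[] refl)
  step {z ∷ u} _     = weighted-merge z u n

Φ-base : Recurrence (λ _ → - 1ℚ) (λ m → Φ m (-[1+ 1 ] ∷ []))
Φ-base n = begin
  q * (ι 2 * calH N (x ∷ []) + 0ℚ)
    ≡⟨ factor q (ι 2) _ ⟩
  ι 2 * (q * calH N (x ∷ []))
    ≡⟨ cong (ι 2 *_) (calH-step x [] n) ⟩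
  ι 2 * (q * calH n (x ∷ []) + S)
    ≡⟨ cong (λ s → ι 2 * (q * calH n (x ∷ []) + s)) S≡ ⟩
  ι 2 * (q * calH n (x ∷ []) + A)
    ≡⟨ unfactor q (ι 2) _ A ⟩
  q * (ι 2 * calH n (x ∷ []) + 0ℚ) + ι 2 * A
    ≡⟨ cong (λ s → q * (ι 2 * calH n (x ∷ []) + 0ℚ) + s) (sumTo-binRatio-alternating n) ⟩
  q * (ι 2 * calH n (x ∷ []) + 0ℚ) + - 1ℚ
    ∎
  where
  open ≡-Reasoning
  N = suc n
  q = ι N * ι N
  x = -[1+ 1 ]
  S = sumTo N (λ k → ι k * ι k * term k x * binRatio N k * 1ℚ)
  A = sumTo N (λ k → sign^ k * binRatio N k)
  S≡ : S ≡ A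
  S≡ = sumTo-cong N λ k 0<k _ → trans (ℚP.*-identityʳ _) (cong (_* binRatio N k) (ι²-*-term-neg2 0<k))
  factor : ∀ q t c → q * (t * c + 0ℚ) ≡ t * (q * c)
  factor = solve 3 (λ q t c → q :* (t :* c :+ con 0ℚ) := t :* (q :* c)) refl
  unfactor : ∀ q t c a → t * (q * c + a) ≡ q * (t * c + 0ℚ) + t * a
  unfactor = solve 4 (λ q t c a → t :* (q :* c :+ a) := q :* (t :* c :+ con 0ℚ) :+ t :* a) refl

-- Induction on the index

recurrence-unique : ∀ {Δ Δ′ f g} → Recurrence Δ f → Recurrence Δ′ g → (∀ n → Δ n ≡ Δ′ n) → f 0 ≡ g 0 →
  ∀ n → f n ≡ g n
recurrence-unique rf rg Δ≗Δ′ f0≡g0 zero    = f0≡g0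
recurrence-unique {Δ} {Δ′} {f} {g} rf rg Δ≗Δ′ f0≡g0 (suc n) = ι-cancelˡ {N ℕ.* N} _ _ (s≤s z≤n) (begin
  ι (N ℕ.* N) * f N   ≡⟨ cong (_* f N) (ι-* N N) ⟩
  q * f N             ≡⟨ rf n ⟩
  q * f n + Δ n       ≡⟨ cong₂ (λ u v → q * u + v) (recurrence-unique rf rg Δ≗Δ′ f0≡g0 n) (Δ≗Δ′ n) ⟩
  q * g n + Δ′ n      ≡⟨ sym (rg n) ⟩
  q * g N             ≡⟨ cong (_* g N) (sym (ι-* N N)) ⟩
  ι (N ℕ.* N) * g N   ∎)
  where
  open ≡-Reasoning
  N = suc n
  q = ι N * ι N

recurrence-neg : ∀ {Δ f} → Recurrence Δ f → Recurrence (λ n → - Δ n) (λ n → - f n)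
recurrence-neg {Δ} {f} rf n =
  trans (sym (ℚP.neg-distribʳ-* q (f (suc n)))) (trans (cong -_ (rf n)) (distrib q (f n) (Δ n)))
  where
  q = ι (suc n) * ι (suc n)
  distrib : ∀ q a d → - (q * a + d) ≡ q * - a + - d
  distrib = solve 3 (λ q a d → :- (q :* a :+ d) := q :* :- a :+ :- d) refl

Hstar-≡-Φ : ∀ {Δ} s S A → Recurrence Δ (λ m → Φ m A) →
  (∀ n → ι (suc n) * ι (suc n) * (term (suc n) s * Hstar (suc n) S) ≡ - Δ n) →
  ∀ m → Hstar m (s ∷ S) ≡ - Φ m A
Hstar-≡-Φ s S A rΦ leading≡ = recurrence-unique rHstar (recurrence-neg rΦ) leading≡ (sym (cong -_ (Φ-zero A)))
  where
  rHstar : Recurrence (λ n → ι (suc n) * ι (suc n) * (term (suc n) s * Hstar (suc n) S)) (λ m → Hstar m (s ∷ S))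
  rHstar n = ℚP.*-distribˡ-+ (ι (suc n) * ι (suc n)) (Hstar n (s ∷ S)) _

leading-2 : ∀ n {X Y} → X ≡ - Y → ι (suc n) * ι (suc n) * (term (suc n) (+ 2) * X) ≡ - Y
leading-2 n {X} {Y} X≡-Y = begin
  ι N * ι N * (term N (+ 2) * X)   ≡⟨ sym (ℚP.*-assoc (ι N * ι N) (term N (+ 2)) X) ⟩
  ι N * ι N * term N (+ 2) * X     ≡⟨ cong (_* X) (ι²-*-term-2 {N} (s≤s z≤n)) ⟩
  1ℚ * X                           ≡⟨ ℚP.*-identityˡ X ⟩
  X                                ≡⟨ X≡-Y ⟩
  - Y                              ∎
  where
  open ≡-Reasoning
  N = suc n

leading-1 : ∀ n {X Y} → X ≡ - Y → ι (suc n) * ι (suc n) * (term (suc n) (+ 1) * X) ≡ - (ι (suc n) * Y)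
leading-1 n {X} {Y} X≡-Y = begin
  ι N * ι N * (term N (+ 1) * X)   ≡⟨ regroup (ι N) (term N (+ 1)) X ⟩
  ι N * ((ι N * term N (+ 1)) * X) ≡⟨ cong (λ u → ι N * (u * X)) (ι-*-term-1 {N} (s≤s z≤n)) ⟩
  ι N * (1ℚ * X)                   ≡⟨ cong (ι N *_) (trans (ℚP.*-identityˡ X) X≡-Y) ⟩
  ι N * - Y                        ≡⟨ sym (ℚP.neg-distribʳ-* (ι N) Y) ⟩
  - (ι N * Y)                      ∎
  where
  open ≡-Reasoning
  N = suc n
  regroup : ∀ n t x → n * n * (t * x) ≡ n * ((n * t) * x)
  regroup = solve 3 (λ n t x → n :* n :* (t :* x) := n :* ((n :* t) :* x)) refl

-- Split in two so that the recursion on the length a of the first block of 2s is structural.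
mutual
  Hstar-sIndex : ∀ as b m → Hstar m (sIndex as (suc b)) ≡ - Φ m (piArgs as (suc b))
  Hstar-sIndex []       zero    =
    Hstar-≡-Φ (+ 2) [] (-[1+ 1 ] ∷ []) Φ-base (λ n → leading-2 n {Y = - 1ℚ} refl)
  Hstar-sIndex []       (suc b) =
    Hstar-≡-Φ (+ 2) (sIndex [] (suc b)) (piArgs [] (suc (suc b))) (Φ-shrink-[] (even-shift b))
      (λ n → leading-2 n (Hstar-sIndex [] b (suc n)))
  Hstar-sIndex (a ∷ as) b       = Hstar-sIndex-∷ a as b

  Hstar-sIndex-∷ : ∀ a as b m → Hstar m (sIndex (a ∷ as) (suc b)) ≡ - Φ m (piArgs (a ∷ as) (suc b))
  Hstar-sIndex-∷ zero    []         b =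
    Hstar-≡-Φ (+ 1) (sIndex [] (suc b)) (piArgs (0 ∷ []) (suc b)) (Φ-merge (ℤ.- (+ (2 ℕ.* suc b))) [])
      (λ n → leading-1 n (Hstar-sIndex [] b (suc n)))
  Hstar-sIndex-∷ zero    (a′ ∷ as′) b =
    Hstar-≡-Φ (+ 1) (sIndex (a′ ∷ as′) (suc b)) (piArgs (0 ∷ a′ ∷ as′) (suc b))
      (Φ-merge (+ (2 ℕ.* a′ ℕ.+ 1)) (piArgs as′ (suc b)))
      (λ n → leading-1 n (Hstar-sIndex (a′ ∷ as′) b (suc n)))
  Hstar-sIndex-∷ (suc a) as         b =
    Hstar-≡-Φ (+ 2) (sIndex (a ∷ as) (suc b)) (piArgs (suc a ∷ as) (suc b))
      (Φ-shrink (odd-shift a) (odd-shift-⊕ a) (piArgs as (suc b)))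
      (λ n → leading-2 n (Hstar-sIndex-∷ a as b (suc n)))

-- The identity holds for n = 0 as well, both sides being 0.
theorem2p3 : (as : List ℕ) (b : ℕ) (n : ℕ) → 1 ≤ n →
    Hstar n (sIndex as (suc b)) ≡ rhs n as (suc b)
theorem2p3 as b n _ = Hstar-sIndex as b n
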